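{- Let $a,b,c,y_1,\ldots,y_{12}$ be distinct $\pm1$-valued variables. Consider the seven sets $$\{a,y_1,y_2,y_3\},\ \{b,y_4,y_5,y_6\},\ \{c,y_7,y_8,y_9\},\ \{c,y_{10},y_{11},y_{12}\},$$ $$\{y_1,y_4,y_7,y_{10}\},\ \{y_2,y_5,y_8,y_{11}\},\ \{y_3,y_6,y_9,y_{12}\},$$ where an assignment satisfies a set if the sum of the values of its four variables is $0$. Then: - no variable appears in more than 2 of these 7 sets; - each of $a$ and $b$ appears in exactly one of them; - no two of these sets share more than one variable; - if all 7 sets are satisfied, then $a=b$; - if $a=b$, then there is an assignment of the remaining variables $c,y_1,\ldots,y_{12}$ that satisfies all 7 sets. -}

module Defs where

open import Data.Nat using (ℕ)
open import Data.Fin using (Fin)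
open import Data.Fin.Properties using (_≟_)
open import Data.Vec using (Vec; []; _∷_; toList)
open import Data.List using (List; []; _∷_; length; filter; sum; map)
open import Data.List.Membership.DecPropositional (_≟_ {15}) using (_∈?_)
open import Data.Integer using (ℤ; +_; -[1+_]; _+_)
open import Data.Sign using (Sign)
open import Relation.Binary.PropositionalEquality using (_≡_)
open import Relation.Nullary.Decidable using (True; toWitness)
import Data.Nat.Properties

-- The 15 variables are indexed by Fin 15:
--   a = 0, b = 1, c = 2, y_i = 2 + i  (i = 1..12).
Var : Set
Var = Fin 15

a b c : Var
a = Data.Fin.zero
b = Data.Fin.suc Data.Fin.zero
c = Data.Fin.suc (Data.Fin.suc Data.Fin.zero)

y : (i : ℕ) → {True (i Data.Nat.<? 13)} → Var
y i {p} = Data.Fin.fromℕ< {2 Data.Nat.+ i} {15}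
  (Data.Nat.Properties.+-monoʳ-< 2 (toWitness p))

val : Sign → ℤ
val Sign.+ = + 1
val Sign.- = -[1+ 0 ]

Assignment : Set
Assignment = Var → Sign

Clause : Set
Clause = Vec Var 4

clauses : List Clause
clauses =
  (a ∷ y 1 ∷ y 2 ∷ y 3 ∷ []) ∷
  (b ∷ y 4 ∷ y 5 ∷ y 6 ∷ []) ∷
  (c ∷ y 7 ∷ y 8 ∷ y 9 ∷ []) ∷
  (c ∷ y 10 ∷ y 11 ∷ y 12 ∷ []) ∷
  (y 1 ∷ y 4 ∷ y 7 ∷ y 10 ∷ []) ∷
  (y 2 ∷ y 5 ∷ y 8 ∷ y 11 ∷ []) ∷
  (y 3 ∷ y 6 ∷ y 9 ∷ y 12 ∷ []) ∷ []

Satisfies : Assignment → Clause → Set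
Satisfies σ (x₁ ∷ x₂ ∷ x₃ ∷ x₄ ∷ []) =
  val (σ x₁) + val (σ x₂) + val (σ x₃) + val (σ x₄) ≡ + 0

occurrences : Var → List Clause → ℕ
occurrences v cs = length (filter (λ C → v ∈? toList C) cs)

shared : Clause → Clause → ℕ
shared C D = length (filter (λ x → x ∈? toList D) (toList C))

-- Every y-variable lies in exactly one of the first four sets and exactly one of
-- the last three, so subtracting the sum of the last three clause sums from the
-- sum of the first four leaves a + b + 2c.  If all seven sums vanish then
-- a + b + 2c = 0, which for ±1 values forces a = b (and c = -a).  Conversely,
-- for a = b = s one sets c = -s and fills the 4 × 3 grid of y's row-wise with
-- (-s, -s, s) twice and (s, s, -s) twice: each row balances its leading
-- variable and each column has two entries of each sign.
module Submission where

open import Defs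
open import Data.Nat using (_≤_; _≤?_)
open import Data.Fin using (Fin)
open import Data.Fin.Properties using (all?; _≟_)
open import Data.List using (lookup; length)
open import Data.List.Relation.Unary.All using (All; []; _∷_)
open import Data.Product using (_×_; Σ; _,_)
open import Data.Sign using (Sign; opposite)
open import Data.Vec using ([]; _∷_)
import Data.Vec as Vec
open import Data.Integer using (ℤ; +_; _+_; _-_)
open import Data.Integer.Tactic.RingSolver using (solve-∀)
open import Relation.Binary.PropositionalEquality using (_≡_; _≢_; refl; trans; cong₂)
open import Relation.Nullary.Decidable using (toWitness; ¬?; _→-dec_)

occurrences≤2 : (v : Var) → occurrences v clauses ≤ 2
occurrences≤2 = toWitness {a? = all? λ v → occurrences v clauses ≤? 2} _

shared≤1 : (i j : Fin (length clauses)) → i ≢ j →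
           shared (lookup clauses i) (lookup clauses j) ≤ 1
shared≤1 = toWitness {a? = all? λ i → all? λ j →
  ¬? (i ≟ j) →-dec shared (lookup clauses i) (lookup clauses j) ≤? 1} _

double-count : ∀ (A B C y₁ y₂ y₃ y₄ y₅ y₆ y₇ y₈ y₉ y₁₀ y₁₁ y₁₂ : ℤ) →
  A + B + (C + C) ≡
    ((A + y₁ + y₂ + y₃) + (B + y₄ + y₅ + y₆)) + ((C + y₇ + y₈ + y₉) + (C + y₁₀ + y₁₁ + y₁₂))
    - ((y₁ + y₄ + y₇ + y₁₀) + (y₂ + y₅ + y₈ + y₁₁) + (y₃ + y₆ + y₉ + y₁₂))
double-count = solve-∀

val+val+2val≡0⇒≡ : ∀ s t u → val s + val t + (val u + val u) ≡ + 0 → s ≡ t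
val+val+2val≡0⇒≡ Sign.+ Sign.+ _      _  = refl
val+val+2val≡0⇒≡ Sign.- Sign.- _      _  = refl
val+val+2val≡0⇒≡ Sign.+ Sign.- Sign.+ ()
val+val+2val≡0⇒≡ Sign.+ Sign.- Sign.- ()
val+val+2val≡0⇒≡ Sign.- Sign.+ Sign.+ ()
val+val+2val≡0⇒≡ Sign.- Sign.+ Sign.- ()

satisfied⇒a≡b : (σ : Assignment) → All (Satisfies σ) clauses → σ a ≡ σ b
satisfied⇒a≡b σ (s₁ ∷ s₂ ∷ s₃ ∷ s₄ ∷ s₅ ∷ s₆ ∷ s₇ ∷ []) =
  val+val+2val≡0⇒≡ (σ a) (σ b) (σ c) (trans
    (double-count (v a) (v b) (v c) (v (y 1)) (v (y 2)) (v (y 3)) (v (y 4)) (v (y 5))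
                  (v (y 6)) (v (y 7)) (v (y 8)) (v (y 9)) (v (y 10)) (v (y 11)) (v (y 12)))
    (cong₂ _-_ (cong₂ _+_ (cong₂ _+_ s₁ s₂) (cong₂ _+_ s₃ s₄))
               (cong₂ _+_ (cong₂ _+_ s₅ s₆) s₇)))
  where
  v : Var → ℤ
  v x = val (σ x)

balancing-assignment : Sign → Assignment
balancing-assignment s = Vec.lookup
  (s ∷ s ∷ s̄ ∷ s̄ ∷ s̄ ∷ s ∷ s̄ ∷ s̄ ∷ s ∷ s ∷ s ∷ s̄ ∷ s ∷ s ∷ s̄ ∷ [])
  where
  s̄ : Sign
  s̄ = opposite s

balancing-assignment-satisfies : ∀ s → All (Satisfies (balancing-assignment s)) clauses
balancing-assignment-satisfies Sign.+ = refl ∷ refl ∷ refl ∷ refl ∷ refl ∷ refl ∷ refl ∷ []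
balancing-assignment-satisfies Sign.- = refl ∷ refl ∷ refl ∷ refl ∷ refl ∷ refl ∷ refl ∷ []

a≡b⇒satisfiable : (sa sb : Sign) → sa ≡ sb →
  Σ Assignment λ σ → σ a ≡ sa × σ b ≡ sb × All (Satisfies σ) clauses
a≡b⇒satisfiable s .s refl =
  balancing-assignment s , refl , refl , balancing-assignment-satisfies s

lemma3p3 :
    ((v : Var) → occurrences v clauses ≤ 2)
    × occurrences a clauses ≡ 1
    × occurrences b clauses ≡ 1
    × ((i j : Fin (length clauses)) → i ≢ j → shared (lookup clauses i) (lookup clauses j) ≤ 1)
    × ((σ : Assignment) → All (Satisfies σ) clauses → σ a ≡ σ b)
    × ((sa sb : Sign) → sa ≡ sb →
        Σ Assignment λ σ → σ a ≡ sa × σ b ≡ sb × All (Satisfies σ) clauses)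
lemma3p3 = occurrences≤2 , refl , refl , shared≤1 , satisfied⇒a≡b , a≡b⇒satisfiable
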